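{- Let $n$ be a positive integer such that the center of $D_n = \langle x, t \mid x^n = t^2 = 1,\ txt = x^{ -1}\rangle$ has order $2$. If $D_n$ contains a $(2n, n-1, \frac{n-2}{2})$ sum set which is type 2 with respect to $Z(D_n)$, then $n \equiv 2 \pmod 4$.
   Context: For a finite group $X$ of order $w$, $T\subseteq X$ with $|T|=k$ is a $(w,k,\mu)$ sum set if every nonidentity element $a\in X$ admits exactly $\mu$ ordered pairs $(y_1,y_2)\in T\times T$ with $y_1y_2 = a$. For a normal subgroup $N$ of order $2$, a sum set $T$ is type 2 with respect to $N$ if $|T\cap N|=1$ and $T$ meets each other coset of $N$ in $0$ or $2$ elements. -}

module Defs where

open import Data.Nat using (ℕ; _+_; _*_; _∸_; NonZero)
open import Data.Nat.DivMod using (_mod_)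
open import Data.Fin using (Fin; toℕ)
open import Data.Fin.Properties using () renaming (_≟_ to _≟F_)
open import Data.Bool using (Bool; true; false; if_then_else_; _xor_; _∧_; not)
open import Data.Bool.Properties using () renaming (_≟_ to _≟B_)
open import Data.Product using (_×_; _,_; proj₁; proj₂)
open import Data.Product.Properties using (≡-dec)
open import Data.List using (List; []; _∷_; concatMap; filterᵇ; length; map)
open import Data.Bool.ListAction using (all; any)
open import Data.List using () renaming (allFin to allFinL)
open import Relation.Nullary using (does; ¬_)
open import Data.Sum using (_⊎_)
open import Relation.Binary.PropositionalEquality using (_≡_)

-- The dihedral group D_n = ⟨ x, t | x^n = t^2 = 1, t x t = x^{-1} ⟩ of order 2n.
-- The element (i , b) represents x^i t^b  (i ∈ Z/n, b = true means a factor t).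
D : ℕ → Set
D n = Fin n × Bool

module _ (n : ℕ) .{{_ : NonZero n}} where

  -- x^i t^a · x^j t^b = x^(i ± j) t^(a xor b), since t x^j = x^(-j) t
  mul : D n → D n → D n
  mul (i , a) (j , b) =
    ((toℕ i + (if a then n ∸ toℕ j else toℕ j)) mod n , a xor b)

  e : D n
  e = (0 mod n , false)

  _≟D_ : (g h : D n) → Bool
  g ≟D h = does (≡-dec _≟F_ _≟B_ g h)

  elems : List (D n)
  elems = concatMap (λ i → (i , false) ∷ (i , true) ∷ []) (allFinL n)

  count : (D n → Bool) → ℕ
  count P = length (filterᵇ P elems)

  center : D n → Bool
  center z = all (λ g → mul z g ≟D mul g z) elems

  pairCount : (D n → Bool) → D n → ℕ
  pairCount T a =
    length (filterᵇ (λ p → T (proj₁ p) ∧ T (proj₂ p) ∧ (mul (proj₁ p) (proj₂ p) ≟D a))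
                    (concatMap (λ y₁ → map (λ y₂ → (y₁ , y₂)) elems) elems))

  -- T is a (2n, k, μ) sum set in D_n  (|D_n| = 2n by construction)
  IsSumSet : ℕ → ℕ → (D n → Bool) → Set
  IsSumSet k μ T = count T ≡ k × (∀ a → ¬ (a ≡ e) → pairCount T a ≡ μ)

  inCoset : (D n → Bool) → D n → D n → Bool
  inCoset N g h = any (λ z → N z ∧ (h ≟D mul g z)) elems

  IsType2 : (D n → Bool) → (D n → Bool) → Set
  IsType2 N T =
    count (λ h → T h ∧ N h) ≡ 1 ×
    (∀ g → N g ≡ false →
       count (λ h → T h ∧ inCoset N g h) ≡ 0 ⊎ count (λ h → T h ∧ inCoset N g h) ≡ 2)

module Submission where

-- Write n = 2h and z = x^h. Multiplication by z on either side is the translation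
-- shift : x^i t^b ↦ x^(i+h) t^b, a fixed-point-free involution with
-- shift g · shift g′ = g · g′, and |Z(D_n)| = 2 forces Z(D_n) = {e, z}.
-- As |T ∩ Z| = 1, T does not contain both e and z, so no factor of a solution of
-- y₁ y₂ = z in T × T is central; since T meets each coset gZ = {g, shift g} outside Z
-- in 0 or 2 elements, (y₁, y₂) ↦ (shift y₁, shift y₂) permutes these solutions
-- without fixed points. Hence μ, their number, is even and n = 2μ + 2 ≡ 2 (mod 4).

open import Defs
open import Data.Nat
  using (ℕ; suc; _+_; _*_; _∸_; _%_; _/_; _≤_; _<_; z≤n; s≤s; NonZero; ≢-nonZero⁻¹; >-nonZero⁻¹)
open import Data.Nat.Properties
  using ( +-assoc; +-comm; +-identityʳ; m∸n+n≡m; m+n∸n≡m; m<m+n; n≢0⇒n>0; 1+n≰n; <⇒≤; n≤1+n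
        ; ≤-trans; ≤-reflexive; +-commutativeSemigroup)
open import Data.Nat.DivMod
  using (_mod_; %-distribˡ-+; m≡m%n+[m/n]*n; m%n≤n; m%n<n; [m+kn]%n≡m%n; [m+n]%n≡m%n; m%n%n≡m%n; m<n⇒m%n≡m)
open import Data.Nat.Divisibility using (_∣_; divides; ∣m∣n⇒∣m+n; ∣-refl; _∣0)
open import Data.Nat.Induction using (<-wellFounded)
open import Data.Nat.Tactic.RingSolver using (solve-∀)
open import Algebra.Properties.CommutativeSemigroup +-commutativeSemigroup using (xy∙z≈xz∙y; interchange)
open import Induction.WellFounded using (Acc; acc)
open import Data.Fin using (Fin; toℕ)
open import Data.Fin.Properties using (toℕ-injective; toℕ-fromℕ<; toℕ<n) renaming (_≟_ to _≟F_)
open import Data.Bool using (Bool; true; false; not; T; _∧_; T?)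
open import Data.Bool.Properties using (T-∧) renaming (_≟_ to _≟B_)
open import Data.Product using (∃-syntax; _×_; _,_; proj₁; proj₂)
open import Data.Product.Properties using (≡-dec)
open import Data.Sum using (_⊎_; inj₁; inj₂)
open import Data.Empty using (⊥; ⊥-elim)
open import Data.List
  using (List; []; _∷_; _++_; map; concatMap; length; filterᵇ; cartesianProductWith; cartesianProduct; allFin)
open import Data.List.Membership.Propositional using (_∈_; lose)
open import Data.List.Membership.Propositional.Properties
  using (∈-∃++; ∈-filter⁺; ∈-filter⁻; ∈-cartesianProduct⁺; ∈-allFin)
open import Data.List.Relation.Unary.Any using (here; there; satisfied)
open import Data.List.Relation.Unary.All as All using (All; []; _∷_)
open import Data.List.Relation.Unary.All.Properties using (all⁻)
open import Data.List.Relation.Unary.Any.Properties using (any⁺; any⁻)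
open import Data.List.Relation.Unary.AllPairs using ([]; _∷_)
open import Data.List.Relation.Unary.Unique.Propositional using (Unique)
open import Data.List.Relation.Unary.Unique.Propositional.Properties using (filter⁺; cartesianProduct⁺; allFin⁺)
open import Data.List.Relation.Binary.Subset.Propositional using (_⊆_)
open import Data.List.Relation.Binary.Permutation.Propositional using (_↭_; prep; ↭-sym; ↭⇒↭ₛ)
open import Data.List.Relation.Binary.Permutation.Propositional.Properties
  using (∈-resp-↭; ↭-length) renaming (shift to ↭-shift)
import Data.List.Relation.Binary.Permutation.Setoid.Properties as ↭ₛ
open import Function using (_∘_; Equivalence)
open import Relation.Nullary using (¬_; yes; no)
open import Relation.Binary.Definitions using (DecidableEquality)
open import Relation.Binary.PropositionalEquality
open import Relation.Binary.PropositionalEquality.Properties using (setoid)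

module _ {A : Set} where

  ∈⇒↭∷ : ∀ {x : A} {xs} → x ∈ xs → ∃[ rest ] xs ↭ x ∷ rest
  ∈⇒↭∷ x∈xs with as , bs , refl ← ∈-∃++ x∈xs = as ++ bs , ↭-shift _ as bs

  Unique-resp-↭ : ∀ {xs ys : List A} → xs ↭ ys → Unique xs → Unique ys
  Unique-resp-↭ σ = ↭ₛ.Unique-resp-↭ (setoid A) (↭⇒↭ₛ σ)

  Unique∧⊆⇒length≤ : ∀ {xs ys : List A} → Unique xs → xs ⊆ ys → length xs ≤ length ys
  Unique∧⊆⇒length≤ {[]} _ _ = z≤n
  Unique∧⊆⇒length≤ {x ∷ xs} {ys} (x∉xs ∷ xs!) xs⊆ys
    with rest , σ ← ∈⇒↭∷ (xs⊆ys (here refl))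
    = subst (suc (length xs) ≤_) (sym (↭-length σ)) (s≤s (Unique∧⊆⇒length≤ xs! xs⊆rest))
    where
    xs⊆rest : xs ⊆ rest
    xs⊆rest {w} w∈xs with ∈-resp-↭ σ (xs⊆ys (there w∈xs))
    ... | here refl = ⊥-elim (All.lookup x∉xs w∈xs refl)
    ... | there w∈rest = w∈rest

involutive⇒injective : ∀ {A : Set} {f : A → A} → (∀ x → f (f x) ≡ x) → ∀ {x y} → f x ≡ f y → x ≡ y
involutive⇒injective {f = f} f-involutive {x} {y} fx≡fy =
  trans (sym (f-involutive x)) (trans (cong f fx≡fy) (f-involutive y))

module _ {A : Set} (f : A → A) (f-involutive : ∀ x → f (f x) ≡ x) (f-fixpoint-free : ∀ x → f x ≢ x) where

  Unique∧closed⇒2∣length : ∀ {ys} → Unique ys → (∀ {y} → y ∈ ys → f y ∈ ys) → 2 ∣ length ys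
  Unique∧closed⇒2∣length = go (<-wellFounded _)
    where
    go : ∀ {ys} → Acc _<_ (length ys) → Unique ys → (∀ {y} → y ∈ ys → f y ∈ ys) → 2 ∣ length ys
    go {[]} _ _ _ = 2 ∣0
    go {y ∷ ys} (acc rec) ys! closed with closed (here refl)
    ... | here fy≡y = ⊥-elim (f-fixpoint-free y fy≡y)
    ... | there fy∈ys
      with rest , σ ← ∈⇒↭∷ fy∈ys
      with (_ ∷ y∉rest) ∷ fy∉rest ∷ rest! ← Unique-resp-↭ (prep y σ) ys!
      = subst (2 ∣_) (sym ∣ys∣≡2+∣rest∣) (∣m∣n⇒∣m+n ∣-refl (go (rec ∣rest∣<∣ys∣) rest! closed′))
      where
      τ : y ∷ ys ↭ y ∷ f y ∷ rest
      τ = prep y σ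
      ∣ys∣≡2+∣rest∣ : length (y ∷ ys) ≡ 2 + length rest
      ∣ys∣≡2+∣rest∣ = ↭-length τ
      ∣rest∣<∣ys∣ : length rest < length (y ∷ ys)
      ∣rest∣<∣ys∣ = subst (length rest <_) (sym ∣ys∣≡2+∣rest∣) (n≤1+n _)
      closed′ : ∀ {w} → w ∈ rest → f w ∈ rest
      closed′ {w} w∈rest with ∈-resp-↭ τ (closed (∈-resp-↭ (↭-sym τ) (there (there w∈rest))))
      ... | here fw≡y             = ⊥-elim (All.lookup fy∉rest w∈rest (trans (cong f (sym fw≡y)) (f-involutive w)))
      ... | there (here fw≡fy)    = ⊥-elim (All.lookup y∉rest w∈rest (sym (involutive⇒injective f-involutive fw≡fy)))
      ... | there (there fw∈rest) = fw∈rest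

concatMap-map≡cartesianProductWith : ∀ {A B C : Set} (f : A → B → C) xs ys →
  concatMap (λ x → map (f x) ys) xs ≡ cartesianProductWith f xs ys
concatMap-map≡cartesianProductWith f []       ys = refl
concatMap-map≡cartesianProductWith f (x ∷ xs) ys = cong (map (f x) ys ++_) (concatMap-map≡cartesianProductWith f xs ys)

module Enumeration {A : Set} {xs : List A} (xs! : Unique xs) (∈xs : ∀ x → x ∈ xs) where

  module _ {p : A → Bool} where

    ∈-filterᵇ⁺ : ∀ {x} → T (p x) → x ∈ filterᵇ p xs
    ∈-filterᵇ⁺ {x} px = ∈-filter⁺ (T? ∘ p) (∈xs x) px

    ∈-filterᵇ⁻ : ∀ {x} → x ∈ filterᵇ p xs → T (p x)
    ∈-filterᵇ⁻ x∈ = proj₂ (∈-filter⁻ (T? ∘ p) {xs = xs} x∈)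

    length-filterᵇ-≥ : ∀ {zs} → Unique zs → (∀ {z} → z ∈ zs → T (p z)) → length zs ≤ length (filterᵇ p xs)
    length-filterᵇ-≥ zs! zs⊨p = Unique∧⊆⇒length≤ zs! (λ z∈zs → ∈-filterᵇ⁺ (zs⊨p z∈zs))

    length-filterᵇ-≤ : ∀ {zs} → (∀ {x} → T (p x) → x ∈ zs) → length (filterᵇ p xs) ≤ length zs
    length-filterᵇ-≤ p⊆zs = Unique∧⊆⇒length≤ (filter⁺ (T? ∘ p) xs!) (λ x∈ → p⊆zs (∈-filterᵇ⁻ x∈))

    2∣length-filterᵇ : ∀ f → (∀ x → f (f x) ≡ x) → (∀ x → f x ≢ x) → (∀ {x} → T (p x) → T (p (f x))) →
                       2 ∣ length (filterᵇ p xs)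
    2∣length-filterᵇ f f-involutive f-fixpoint-free p-closed =
      Unique∧closed⇒2∣length f f-involutive f-fixpoint-free (filter⁺ (T? ∘ p) xs!)
        (λ x∈ → ∈-filterᵇ⁺ (p-closed (∈-filterᵇ⁻ x∈)))

    length-filterᵇ≡2⇒ : DecidableEquality A → length (filterᵇ p xs) ≡ 2 →
                        ∀ {a b c} → a ≢ b → T (p a) → T (p b) → T (p c) → c ≡ a ⊎ c ≡ b
    length-filterᵇ≡2⇒ _≟_ ∣p∣≡2 {a} {b} {c} a≢b pa pb pc with c ≟ a | c ≟ b
    ... | yes c≡a | _       = inj₁ c≡a
    ... | no _    | yes c≡b = inj₂ c≡b
    ... | no c≢a  | no c≢b  = ⊥-elim (1+n≰n (≤-trans (length-filterᵇ-≥ abc! abc⊨p) (≤-reflexive ∣p∣≡2)))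
      where
      abc! : Unique (a ∷ b ∷ c ∷ [])
      abc! = (a≢b ∷ (c≢a ∘ sym) ∷ []) ∷ ((c≢b ∘ sym) ∷ []) ∷ [] ∷ []
      abc⊨p : ∀ {z} → z ∈ a ∷ b ∷ c ∷ [] → T (p z)
      abc⊨p (here refl)                 = pa
      abc⊨p (there (here refl))         = pb
      abc⊨p (there (there (here refl))) = pc

module _ {d : ℕ} .{{_ : NonZero d}} where

  %-cong-+ : ∀ {m n o p} → m % d ≡ o % d → n % d ≡ p % d → (m + n) % d ≡ (o + p) % d
  %-cong-+ {m} {n} {o} {p} m≡o n≡p = begin
    (m + n) % d         ≡⟨ %-distribˡ-+ m n d ⟩
    (m % d + n % d) % d ≡⟨ cong₂ (λ x y → (x + y) % d) m≡o n≡p ⟩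
    (o % d + p % d) % d ≡⟨ %-distribˡ-+ o p d ⟨
    (o + p) % d         ∎
    where open ≡-Reasoning

  [m+[d∸n%d]+n]%d≡m%d : ∀ m n → (m + (d ∸ n % d) + n) % d ≡ m % d
  [m+[d∸n%d]+n]%d≡m%d m n = begin
    (m + r + n) % d                     ≡⟨ cong (λ x → (m + r + x) % d) (m≡m%n+[m/n]*n n d) ⟩
    (m + r + (n % d + n / d * d)) % d   ≡⟨ cong (_% d) (+-assoc (m + r) (n % d) _) ⟨
    (m + r + n % d + n / d * d) % d     ≡⟨ cong (λ x → (x + n / d * d) % d) (+-assoc m r (n % d)) ⟩
    (m + (r + n % d) + n / d * d) % d   ≡⟨ cong (λ x → (m + x + n / d * d) % d) (m∸n+n≡m (m%n≤n n d)) ⟩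
    (m + d + n / d * d) % d             ≡⟨ [m+kn]%n≡m%n (m + d) (n / d) d ⟩
    (m + d) % d                         ≡⟨ [m+n]%n≡m%n m d ⟩
    m % d                               ∎
    where
    r = d ∸ n % d
    open ≡-Reasoning

  %-cancelʳ-+ : ∀ {m n} o → (m + o) % d ≡ (n + o) % d → m % d ≡ n % d
  %-cancelʳ-+ {m} {n} o eq = begin
    m % d             ≡⟨ [m+[d∸n%d]+n]%d≡m%d m o ⟨
    (m + r + o) % d   ≡⟨ cong (_% d) (xy∙z≈xz∙y m r o) ⟩
    (m + o + r) % d   ≡⟨ %-cong-+ eq refl ⟩
    (n + o + r) % d   ≡⟨ cong (_% d) (xy∙z≈xz∙y n o r) ⟩
    (n + r + o) % d   ≡⟨ [m+[d∸n%d]+n]%d≡m%d n o ⟩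
    n % d             ∎
    where
    r = d ∸ o % d
    open ≡-Reasoning

module Dihedral {n : ℕ} .{{_ : NonZero n}} (h : ℕ) (h+h≡n : h + h ≡ n) where

  _·_ : D n → D n → D n
  _·_ = mul n

  rot : ℕ → Bool → D n
  rot i b = (i mod n , b)

  shift : D n → D n
  shift (i , b) = rot (toℕ i + h) b

  z : D n
  z = rot h false

  h≢0 : h ≢ 0
  h≢0 refl = ≢-nonZero⁻¹ n (sym h+h≡n)

  h<n : h < n
  h<n = subst (h <_) h+h≡n (m<m+n h (n≢0⇒n>0 h≢0))

  toℕ-mod : ∀ i → toℕ (i mod n) ≡ i % n
  toℕ-mod i = toℕ-fromℕ< (m%n<n i n)

  toℕ-mod-% : ∀ i → toℕ (i mod n) % n ≡ i % n
  toℕ-mod-% i = trans (cong (_% n) (toℕ-mod i)) (m%n%n≡m%n i n)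

  toℕ-h-mod : toℕ (h mod n) ≡ h
  toℕ-h-mod = trans (toℕ-mod h) (m<n⇒m%n≡m h<n)

  toℕ-0-mod : toℕ (0 mod n) ≡ 0
  toℕ-0-mod = trans (toℕ-mod 0) (m<n⇒m%n≡m (>-nonZero⁻¹ n))

  rot-cong : ∀ {i j} b → i % n ≡ j % n → rot i b ≡ rot j b
  rot-cong {i} {j} b i≡j = cong (_, b) (toℕ-injective (trans (toℕ-mod i) (trans i≡j (sym (toℕ-mod j)))))

  rot-toℕ : ∀ (i : Fin n) b → rot (toℕ i) b ≡ (i , b)
  rot-toℕ i b = cong (_, b) (toℕ-injective (trans (toℕ-mod (toℕ i)) (m<n⇒m%n≡m (toℕ<n i))))

  shift-e : shift (e n) ≡ z
  shift-e = cong (λ x → rot (x + h) false) toℕ-0-mod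

  ·-identityˡ : ∀ g → e n · g ≡ g
  ·-identityˡ (j , b) = trans (cong (λ x → rot (x + toℕ j) b) toℕ-0-mod) (rot-toℕ j b)

  ·-identityʳ : ∀ g → g · e n ≡ g
  ·-identityʳ (i , false) = trans (cong (λ x → rot (toℕ i + x) false) toℕ-0-mod)
                              (trans (cong (λ x → rot x false) (+-identityʳ (toℕ i))) (rot-toℕ i false))
  ·-identityʳ (i , true)  = trans (cong (λ x → rot (toℕ i + (n ∸ x)) true) toℕ-0-mod)
                              (trans (rot-cong true ([m+n]%n≡m%n (toℕ i) n)) (rot-toℕ i true))

  z·g≡shift : ∀ g → z · g ≡ shift g
  z·g≡shift (j , b) = rot-cong b (trans (%-cong-+ (toℕ-mod-% h) refl) (cong (_% n) (+-comm h (toℕ j))))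

  g·z≡shift : ∀ g → g · z ≡ shift g
  g·z≡shift (i , false) = rot-cong false (%-cong-+ refl (toℕ-mod-% h))
  g·z≡shift (i , true)  = begin
    rot (toℕ i + (n ∸ toℕ (h mod n))) true ≡⟨ cong (λ x → rot (toℕ i + (n ∸ x)) true) toℕ-h-mod ⟩
    rot (toℕ i + (n ∸ h)) true             ≡⟨ cong (λ x → rot (toℕ i + (x ∸ h)) true) h+h≡n ⟨
    rot (toℕ i + (h + h ∸ h)) true         ≡⟨ cong (λ x → rot (toℕ i + x) true) (m+n∸n≡m h h) ⟩
    rot (toℕ i + h) true                   ∎
    where open ≡-Reasoning

  shift-involutive : ∀ g → shift (shift g) ≡ g
  shift-involutive (i , b) = trans (rot-cong b i+h+h≡i) (rot-toℕ i b)
    where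
    i+h+h≡i : (toℕ ((toℕ i + h) mod n) + h) % n ≡ toℕ i % n
    i+h+h≡i = begin
      (toℕ ((toℕ i + h) mod n) + h) % n ≡⟨ %-cong-+ (toℕ-mod-% (toℕ i + h)) refl ⟩
      (toℕ i + h + h) % n               ≡⟨ cong (_% n) (trans (+-assoc (toℕ i) h h) (cong (toℕ i +_) h+h≡n)) ⟩
      (toℕ i + n) % n                   ≡⟨ [m+n]%n≡m%n (toℕ i) n ⟩
      toℕ i % n                         ∎
      where open ≡-Reasoning

  shift-fixpoint-free : ∀ g → shift g ≢ g
  shift-fixpoint-free (i , b) shift-g≡g =
    h≢0 (trans (sym (m<n⇒m%n≡m h<n)) (trans (%-cancelʳ-+ (toℕ i) h+i≡0+i) (m<n⇒m%n≡m (>-nonZero⁻¹ n))))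
    where
    h+i≡0+i : (h + toℕ i) % n ≡ (0 + toℕ i) % n
    h+i≡0+i = begin
      (h + toℕ i) % n          ≡⟨ cong (_% n) (+-comm h (toℕ i)) ⟩
      (toℕ i + h) % n          ≡⟨ toℕ-mod (toℕ i + h) ⟨
      toℕ ((toℕ i + h) mod n)  ≡⟨ cong (toℕ ∘ proj₁) shift-g≡g ⟩
      toℕ i                    ≡⟨ m<n⇒m%n≡m (toℕ<n i) ⟨
      toℕ i % n                ∎
      where open ≡-Reasoning

  +h-+h-% : ∀ i j → (toℕ ((i + h) mod n) + toℕ ((j + h) mod n)) % n ≡ (i + j) % n
  +h-+h-% i j = begin
    (toℕ ((i + h) mod n) + toℕ ((j + h) mod n)) % n ≡⟨ %-cong-+ (toℕ-mod-% (i + h)) (toℕ-mod-% (j + h)) ⟩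
    (i + h + (j + h)) % n                           ≡⟨ cong (_% n) (interchange i h j h) ⟩
    (i + j + (h + h)) % n                           ≡⟨ cong (λ x → (i + j + x) % n) h+h≡n ⟩
    (i + j + n) % n                                 ≡⟨ [m+n]%n≡m%n (i + j) n ⟩
    (i + j) % n                                     ∎
    where open ≡-Reasoning

  +h-∸+h-% : ∀ i j → j ≤ n → (toℕ ((i + h) mod n) + (n ∸ toℕ ((j + h) mod n))) % n ≡ (i + (n ∸ j)) % n
  +h-∸+h-% i j j≤n = %-cancelʳ-+ (j + h) (trans lhs (sym rhs))
    where
    open ≡-Reasoning
    lhs : (toℕ ((i + h) mod n) + (n ∸ toℕ ((j + h) mod n)) + (j + h)) % n ≡ (i + h) % n
    lhs = begin
      (toℕ ((i + h) mod n) + (n ∸ toℕ ((j + h) mod n)) + (j + h)) % n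
        ≡⟨ cong (λ x → (toℕ ((i + h) mod n) + (n ∸ x) + (j + h)) % n) (toℕ-mod (j + h)) ⟩
      (toℕ ((i + h) mod n) + (n ∸ (j + h) % n) + (j + h)) % n
        ≡⟨ [m+[d∸n%d]+n]%d≡m%d (toℕ ((i + h) mod n)) (j + h) ⟩
      toℕ ((i + h) mod n) % n
        ≡⟨ toℕ-mod-% (i + h) ⟩
      (i + h) % n ∎
    rhs : (i + (n ∸ j) + (j + h)) % n ≡ (i + h) % n
    rhs = begin
      (i + (n ∸ j) + (j + h)) % n ≡⟨ cong (_% n) (+-assoc (i + (n ∸ j)) j h) ⟨
      (i + (n ∸ j) + j + h) % n   ≡⟨ cong (λ x → (x + h) % n) (+-assoc i (n ∸ j) j) ⟩
      (i + (n ∸ j + j) + h) % n   ≡⟨ cong (λ x → (i + x + h) % n) (m∸n+n≡m j≤n) ⟩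
      (i + n + h) % n             ≡⟨ cong (_% n) (xy∙z≈xz∙y i n h) ⟩
      (i + h + n) % n             ≡⟨ [m+n]%n≡m%n (i + h) n ⟩
      (i + h) % n                 ∎

  shift·shift : ∀ g g′ → shift g · shift g′ ≡ g · g′
  shift·shift (i , false) (j , b) = rot-cong b (+h-+h-% (toℕ i) (toℕ j))
  shift·shift (i , true)  (j , b) = rot-cong (not b) (+h-∸+h-% (toℕ i) (toℕ j) (<⇒≤ (toℕ<n j)))

  shift-injective : ∀ {g g′} → shift g ≡ shift g′ → g ≡ g′
  shift-injective = involutive⇒injective shift-involutive

  z≢e : z ≢ e n
  z≢e z≡e = shift-fixpoint-free (e n) (trans shift-e z≡e)

  z·g≡z⇒g≡e : ∀ {g} → z · g ≡ z → g ≡ e n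
  z·g≡z⇒g≡e z·g≡z = shift-injective (trans (sym (z·g≡shift _)) (trans z·g≡z (sym shift-e)))

  g·z≡z⇒g≡e : ∀ {g} → g · z ≡ z → g ≡ e n
  g·z≡z⇒g≡e g·z≡z = shift-injective (trans (sym (g·z≡shift _)) (trans g·z≡z (sym shift-e)))

module _ {n : ℕ} .{{_ : NonZero n}} where

  ≡⇒≟D : ∀ {g g′ : D n} → g ≡ g′ → T (_≟D_ n g g′)
  ≡⇒≟D {g} {g′} g≡g′ with ≡-dec _≟F_ _≟B_ g g′
  ... | yes _    = _
  ... | no g≢g′ = g≢g′ g≡g′

  ≟D⇒≡ : ∀ {g g′ : D n} → T (_≟D_ n g g′) → g ≡ g′
  ≟D⇒≡ {g} {g′} g≟g′ with ≡-dec _≟F_ _≟B_ g g′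
  ... | yes g≡g′ = g≡g′

  elems≡cartesianProduct : elems n ≡ cartesianProduct (allFin n) (false ∷ true ∷ [])
  elems≡cartesianProduct = concatMap-map≡cartesianProductWith _,_ (allFin n) (false ∷ true ∷ [])

  elems! : Unique (elems n)
  elems! = subst Unique (sym elems≡cartesianProduct) (cartesianProduct⁺ (allFin⁺ n) (((λ ()) ∷ []) ∷ [] ∷ []))

  ∈-elems : ∀ g → g ∈ elems n
  ∈-elems (i , b) = subst ((i , b) ∈_) (sym elems≡cartesianProduct) (∈-cartesianProduct⁺ (∈-allFin i) (∈-bools b))
    where
    ∈-bools : ∀ b → b ∈ false ∷ true ∷ []
    ∈-bools false = here refl
    ∈-bools true  = there (here refl)

  pairs : List (D n × D n)
  pairs = concatMap (λ y₁ → map (λ y₂ → (y₁ , y₂)) (elems n)) (elems n)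

  pairs≡cartesianProduct : pairs ≡ cartesianProduct (elems n) (elems n)
  pairs≡cartesianProduct = concatMap-map≡cartesianProductWith _,_ (elems n) (elems n)

  pairs! : Unique pairs
  pairs! = subst Unique (sym pairs≡cartesianProduct) (cartesianProduct⁺ elems! elems!)

  ∈-pairs : ∀ p → p ∈ pairs
  ∈-pairs (y₁ , y₂) =
    subst ((y₁ , y₂) ∈_) (sym pairs≡cartesianProduct) (∈-cartesianProduct⁺ (∈-elems y₁) (∈-elems y₂))

  central⁺ : ∀ {g} → (∀ g′ → mul n g g′ ≡ mul n g′ g) → T (center n g)
  central⁺ {g} comm = all⁻ _ (All.universal (λ g′ → ≡⇒≟D (comm g′)) (elems n))

¬T⇒≡false : ∀ {b} → ¬ T b → b ≡ false
¬T⇒≡false {false} _  = refl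
¬T⇒≡false {true}  ¬t = ⊥-elim (¬t _)

∧-intro : ∀ {a b} → T a → T b → T (a ∧ b)
∧-intro ta tb = Equivalence.from T-∧ (ta , tb)

module Type2 {n : ℕ} .{{_ : NonZero n}} (h : ℕ) (h+h≡n : h + h ≡ n) (S : D n → Bool)
             (∣Z∣≡2 : count n (center n) ≡ 2) (type2 : IsType2 n (center n) S) where

  open Dihedral h h+h≡n
  open Enumeration (elems! {n}) ∈-elems

  Z : D n → Bool
  Z = center n

  e-central : T (Z (e n))
  e-central = central⁺ (λ g → trans (·-identityˡ g) (sym (·-identityʳ g)))

  z-central : T (Z z)
  z-central = central⁺ (λ g → trans (z·g≡shift g) (sym (g·z≡shift g)))

  central⇒e⊎z : ∀ {g} → T (Z g) → g ≡ e n ⊎ g ≡ z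
  central⇒e⊎z = length-filterᵇ≡2⇒ (≡-dec _≟F_ _≟B_) ∣Z∣≡2 (z≢e ∘ sym) e-central z-central

  ¬S[e]∧S[z] : T (S (e n)) → T (S z) → ⊥
  ¬S[e]∧S[z] Se Sz = 1+n≰n (≤-trans (length-filterᵇ-≥ ez! ez∈S∩Z) (≤-reflexive (proj₁ type2)))
    where
    ez! : Unique (e n ∷ z ∷ [])
    ez! = ((z≢e ∘ sym) ∷ []) ∷ [] ∷ []
    ez∈S∩Z : ∀ {g} → g ∈ e n ∷ z ∷ [] → T (S g ∧ Z g)
    ez∈S∩Z (here refl)         = ∧-intro Se e-central
    ez∈S∩Z (there (here refl)) = ∧-intro Sz z-central

  g∈gZ : ∀ g → T (inCoset n Z g g)
  g∈gZ g = any⁺ _ (lose (∈-elems (e n)) (∧-intro e-central (≡⇒≟D (sym (·-identityʳ g)))))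

  ∈gZ⇒≡g⊎≡shift : ∀ {g x} → T (inCoset n Z g x) → x ≡ g ⊎ x ≡ shift g
  ∈gZ⇒≡g⊎≡shift {g} {x} x∈gZ with c , Zc∧x≡gc ← satisfied (any⁻ _ (elems n) x∈gZ)
    with Zc , x≟gc ← Equivalence.to T-∧ Zc∧x≡gc
    with central⇒e⊎z {c} Zc
  ... | inj₁ refl = inj₁ (trans (≟D⇒≡ x≟gc) (·-identityʳ g))
  ... | inj₂ refl = inj₂ (trans (≟D⇒≡ x≟gc) (g·z≡shift g))

  S-shift : ∀ {g} → ¬ T (Z g) → T (S g) → T (S (shift g))
  S-shift {g} g∉Z Sg with T? (S (shift g))
  ... | yes S[gz] = S[gz]
  ... | no ¬S[gz] with proj₂ type2 g (¬T⇒≡false g∉Z)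
  ...   | inj₁ ∣S∩gZ∣≡0 = ⊥-elim (1+n≰n (subst (1 ≤_) ∣S∩gZ∣≡0 (length-filterᵇ-≥ ([] ∷ []) g∈S∩gZ)))
    where
    g∈S∩gZ : ∀ {x} → x ∈ g ∷ [] → T (S x ∧ inCoset n Z g x)
    g∈S∩gZ (here refl) = ∧-intro Sg (g∈gZ g)
  ...   | inj₂ ∣S∩gZ∣≡2 = ⊥-elim (1+n≰n (subst (_≤ 1) ∣S∩gZ∣≡2 (length-filterᵇ-≤ S∩gZ⊆g)))
    where
    S∩gZ⊆g : ∀ {x} → T (S x ∧ inCoset n Z g x) → x ∈ g ∷ []
    S∩gZ⊆g Sx∧x∈gZ with Sx , x∈gZ ← Equivalence.to T-∧ Sx∧x∈gZ with ∈gZ⇒≡g⊎≡shift x∈gZ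
    ... | inj₁ x≡g  = here x≡g
    ... | inj₂ refl = ⊥-elim (¬S[gz] Sx)

  left-factor-of-z-noncentral : ∀ {y₁ y₂} → T (S y₁) → T (S y₂) → y₁ · y₂ ≡ z → ¬ T (Z y₁)
  left-factor-of-z-noncentral {y₁} {y₂} S₁ S₂ y₁y₂≡z Z₁ with central⇒e⊎z {y₁} Z₁
  ... | inj₁ refl = ¬S[e]∧S[z] S₁ (subst (T ∘ S) (trans (sym (·-identityˡ y₂)) y₁y₂≡z) S₂)
  ... | inj₂ refl = ¬S[e]∧S[z] (subst (T ∘ S) (z·g≡z⇒g≡e y₁y₂≡z) S₂) S₁

  right-factor-of-z-noncentral : ∀ {y₁ y₂} → T (S y₁) → T (S y₂) → y₁ · y₂ ≡ z → ¬ T (Z y₂)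
  right-factor-of-z-noncentral {y₁} {y₂} S₁ S₂ y₁y₂≡z Z₂ with central⇒e⊎z {y₂} Z₂
  ... | inj₁ refl = ¬S[e]∧S[z] S₂ (subst (T ∘ S) (trans (sym (·-identityʳ y₁)) y₁y₂≡z) S₁)
  ... | inj₂ refl = ¬S[e]∧S[z] (subst (T ∘ S) (g·z≡z⇒g≡e y₁y₂≡z) S₁) S₂

  shift² : D n × D n → D n × D n
  shift² (y₁ , y₂) = (shift y₁ , shift y₂)

  factorises-z : D n × D n → Bool
  factorises-z p = S (proj₁ p) ∧ S (proj₂ p) ∧ (_≟D_ n (proj₁ p · proj₂ p) z)

  factorises-z-shift² : ∀ {p} → T (factorises-z p) → T (factorises-z (shift² p))
  factorises-z-shift² {y₁ , y₂} t
    with S₁ , S₂∧y₁y₂≟z ← Equivalence.to T-∧ t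
    with S₂ , y₁y₂≟z ← Equivalence.to T-∧ S₂∧y₁y₂≟z =
    ∧-intro (S-shift (left-factor-of-z-noncentral S₁ S₂ y₁y₂≡z) S₁)
      (∧-intro (S-shift (right-factor-of-z-noncentral S₁ S₂ y₁y₂≡z) S₂)
        (≡⇒≟D (trans (shift·shift y₁ y₂) y₁y₂≡z)))
    where
    y₁y₂≡z : y₁ · y₂ ≡ z
    y₁y₂≡z = ≟D⇒≡ y₁y₂≟z

  2∣pairCount-z : 2 ∣ pairCount n S z
  2∣pairCount-z =
    Enumeration.2∣length-filterᵇ pairs! ∈-pairs shift² shift²-involutive shift²-fixpoint-free factorises-z-shift²
    where
    shift²-involutive : ∀ p → shift² (shift² p) ≡ p
    shift²-involutive (y₁ , y₂) = cong₂ _,_ (shift-involutive y₁) (shift-involutive y₂)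
    shift²-fixpoint-free : ∀ p → shift² p ≢ p
    shift²-fixpoint-free (y₁ , _) = shift-fixpoint-free y₁ ∘ cong proj₁

2∣μ⇒[2μ+2]%4≡2 : ∀ {μ} → 2 ∣ μ → (2 * μ + 2) % 4 ≡ 2
2∣μ⇒[2μ+2]%4≡2 (divides q refl) = trans (cong (_% 4) (rearrange q)) ([m+kn]%n≡m%n 2 q 4)
  where
  rearrange : ∀ q → 2 * (q * 2) + 2 ≡ 2 + q * 4
  rearrange = solve-∀

lemma6p2 : (n : ℕ) .{{_ : NonZero n}} → count n (center n) ≡ 2 →
    (μ : ℕ) → 2 * μ + 2 ≡ n →
    (T : D n → Bool) → IsSumSet n (n ∸ 1) μ T → IsType2 n (center n) T →
    n % 4 ≡ 2
lemma6p2 n ∣Z∣≡2 μ 2μ+2≡n S (_ , pairCount≡μ) type2 =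
  subst (λ m → m % 4 ≡ 2) 2μ+2≡n (2∣μ⇒[2μ+2]%4≡2 (subst (2 ∣_) (pairCount≡μ z z≢e) 2∣pairCount-z))
  where
  h+h≡n : suc μ + suc μ ≡ n
  h+h≡n = trans (double-suc μ) 2μ+2≡n
    where
    double-suc : ∀ μ → suc μ + suc μ ≡ 2 * μ + 2
    double-suc = solve-∀
  open Type2 (suc μ) h+h≡n S ∣Z∣≡2 type2
  open Dihedral (suc μ) h+h≡n using (z; z≢e)
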